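{- Let $A$ and $B$ be finite simple connected graphs, each of which is both distance degree regular and LC. Then the Cartesian product $A\square B$ is distance degree regular and LC.
   Context: A finite sequence $(s_0,\dots,s_d)$ of nonnegative integers is log-concave if $s_i^2 \ge s_{i-1}s_{i+1}$ for every $1 \le i \le d-1$. For a vertex $x$ of a graph $G$ of diameter $d$, let $G_i(x)$ be the set of vertices at geodetic distance exactly $i$ from $x$. $G$ is distance degree regular (DDR) if for every $0\le i\le d$ the number $|G_i(x)|$ does not depend on the vertex $x$. $G$ is called LC if it has at least one vertex $x$ such that $(|G_i(x)|)_{0\le i\le d}$ is log-concave. The Cartesian product $G\square H$ has vertex set $V(G)\times V(H)$, with $(u,v)$ adjacent to $(u',v')$ iff either $u=u'$ and $v\sim v'$ in $H$, or $v=v'$ and $u\sim u'$ in $G$. -}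

module Defs where

open import Data.Nat using (ℕ; zero; suc; _+_; _*_; _≤_; _<_)
open import Data.Bool using (Bool; true; false; _∧_; _∨_; not; if_then_else_)
open import Data.Fin using (Fin; remQuot)
open import Data.Fin.Properties using (_≟_)
open import Data.List using (List; allFin; map; upTo)
open import Data.Bool.ListAction using (any)
open import Data.Nat.ListAction using (sum)
open import Data.Bool.Properties using (∧-zeroʳ)
open import Relation.Nullary using (yes; no)
open import Data.Empty using (⊥-elim)
open import Data.Product using (Σ; ∃; ∃-syntax; _×_; _,_; proj₁; proj₂)
open import Relation.Nullary.Decidable using (⌊_⌋)
open import Relation.Binary.PropositionalEquality using (_≡_; refl; cong₂; trans; cong)

eqsym : ∀ {m} (a b : Fin m) → ⌊ a ≟ b ⌋ ≡ ⌊ b ≟ a ⌋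
eqsym a b with a ≟ b | b ≟ a
... | yes _ | yes _ = refl
... | no _ | no _ = refl
... | yes refl | no q = ⊥-elim (q refl)
... | no q | yes refl = ⊥-elim (q refl)

record Graph : Set where
  field
    n      : ℕ
    adj    : Fin n → Fin n → Bool
    sym    : ∀ x y → adj x y ≡ adj y x
    irrefl : ∀ x → adj x x ≡ false
open Graph public

module _ (G : Graph) where
  private V = Fin (n G)

  anyV : (V → Bool) → Bool
  anyV p = any p (allFin (n G))

  walk : ℕ → V → V → Bool
  walk zero    x y = ⌊ x ≟ y ⌋
  walk (suc k) x y = anyV (λ z → adj G x z ∧ walk k z y)

  walkBelow : ℕ → V → V → Bool
  walkBelow k x y = any (λ j → walk j x y) (upTo k)

  distIs : ℕ → V → V → Bool
  distIs i x y = walk i x y ∧ not (walkBelow i x y)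

  sphere : V → ℕ → ℕ
  sphere x i = sum (map (λ y → if distIs i x y then 1 else 0) (allFin (n G)))

  Connected : Set
  Connected = ∀ x y → ∃[ k ] (walk k x y ≡ true)

  IsDiameter : ℕ → Set
  IsDiameter d = (∀ x y → walkBelow (suc d) x y ≡ true)
               × (∃[ x ] ∃[ y ] (distIs d x y ≡ true))

  DDR : Set
  DDR = ∀ d → IsDiameter d → ∀ i → i ≤ d → ∀ x y → sphere x i ≡ sphere y i

LogConcave : (ℕ → ℕ) → ℕ → Set
LogConcave s d = ∀ i → 1 ≤ i → i + 1 ≤ d → s (i Data.Nat.∸ 1) * s (i + 1) ≤ s i * s i

LC : Graph → Set
LC G = Σ ℕ λ d → IsDiameter G d × ∃[ x ] LogConcave (sphere G x) d

-- Cartesian product; vertex set Fin (n A * n B) ≅ Fin (n A) × Fin (n B) via remQuot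
-- (u,v) ~ (u',v')  iff  (u = u' and v ~ v' in B) or (v = v' and u ~ u' in A)
fstV : (A B : Graph) → Fin (n A * n B) → Fin (n A)
fstV A B p = proj₁ (remQuot {n A} (n B) p)

sndV : (A B : Graph) → Fin (n A * n B) → Fin (n B)
sndV A B p = proj₂ (remQuot {n A} (n B) p)

prodAdj : (A B : Graph) → Fin (n A * n B) → Fin (n A * n B) → Bool
prodAdj A B p q = (⌊ fstV A B p ≟ fstV A B q ⌋ ∧ adj B (sndV A B p) (sndV A B q))
                ∨ (⌊ sndV A B p ≟ sndV A B q ⌋ ∧ adj A (fstV A B p) (fstV A B q))

prodSym : (A B : Graph) → ∀ p q → prodAdj A B p q ≡ prodAdj A B q p
prodSym A B p q = cong₂ _∨_
  (cong₂ _∧_ (eqsym (fstV A B p) (fstV A B q)) (Graph.sym B (sndV A B p) (sndV A B q)))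
  (cong₂ _∧_ (eqsym (sndV A B p) (sndV A B q)) (Graph.sym A (fstV A B p) (fstV A B q)))

prodIrr : (A B : Graph) → ∀ p → prodAdj A B p p ≡ false
prodIrr A B p = cong₂ _∨_
  (trans (cong (⌊ fstV A B p ≟ fstV A B p ⌋ ∧_) (irrefl B (sndV A B p))) (∧-zeroʳ _))
  (trans (cong (⌊ sndV A B p ≟ sndV A B p ⌋ ∧_) (irrefl A (fstV A B p))) (∧-zeroʳ _))

_□_ : Graph → Graph → Graph
A □ B = record { n = n A * n B ; adj = prodAdj A B ; sym = prodSym A B ; irrefl = prodIrr A B }

{-# OPTIONS --safe #-}
module Submission where

-- Distances in A □ B add up coordinatewise, so the sphere sizes of A □ B around (u , v) form the
-- convolution of the sphere sequences of A around u and of B around v. Convolution respects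
-- pointwise equality, which gives distance degree regularity. It also preserves log-concavity of
-- sequences without internal zeros, and sphere sequences have none: a vertex at distance j + 1 has a
-- neighbour at distance j. For c = a ∗ b, the numbers c k, c (k + 1), c (k + 2) are dot products of
-- two consecutive rows of the Toeplitz matrix (a (r − s)) with b and with b shifted by one; these two
-- pairs of vectors are ordered by likelihood ratio because a and b are log-concave, and the 2 × 2
-- Cauchy–Binet formula then gives c k · c (k + 2) ≤ c (k + 1)².

open import Defs hiding (sym)
open import Data.Nat using (ℕ; zero; suc; _+_; _*_; _∸_; _≤_; _<_; z≤n; s≤s; _≡ᵇ_; NonZero; ≢-nonZero)
open import Data.Nat.Properties
open import Data.Nat.Tactic.RingSolver using (solve-∀)
import Data.Nat.ListAction as List
open import Data.Fin using (Fin; zero; suc; toℕ; _↑ˡ_; _↑ʳ_; combine)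
import Data.Fin.Properties as Finₚ
open import Data.Bool using (Bool; true; false; T; T?; not; _∧_; if_then_else_)
open import Data.Bool.Properties using (T-∧; T-∨; T-≡)
open import Data.Bool.ListAction using (any)
open import Data.List using (allFin; map; tabulate; upTo)
open import Data.List.Properties using (map-tabulate)
open import Data.List.Relation.Unary.Any using (satisfied)
open import Data.List.Relation.Unary.Any.Properties using (any⁺; any⁻)
open import Data.List.Membership.Propositional using (lose; find)
open import Data.List.Membership.Propositional.Properties using (∈-allFin; ∈-upTo⁺; ∈-upTo⁻)
open import Data.Unit using (tt)
open import Data.Empty using (⊥-elim)
open import Data.Product using (∃; ∃-syntax; _×_; _,_; proj₁; proj₂)
open import Data.Sum using (_⊎_; inj₁; inj₂)
open import Function using (_∘_; Equivalence; _⇔_; mk⇔)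
open import Relation.Nullary using (¬_; yes; no; contradiction)
open import Relation.Nullary.Decidable using (toWitness; fromWitness)
open import Relation.Binary using (tri<; tri≈; tri>)
open import Relation.Binary.PropositionalEquality
open import Algebra.Properties.Semiring.Sum +-*-semiring
  using (sum-syntax; sum-cong-≗; sum-replicate-zero; ∑-comm; ∑-distrib-+; *-distribˡ-sum; *-distribʳ-sum)

∑-↑ : ∀ m n (f : Fin (m + n) → ℕ) →
      ∑[ i < m + n ] f i ≡ ∑[ i < m ] f (i ↑ˡ n) + ∑[ j < n ] f (m ↑ʳ j)
∑-↑ zero    n f = refl
∑-↑ (suc m) n f = trans (cong (f zero +_) (∑-↑ m n (λ i → f (suc i)))) (sym (+-assoc (f zero) _ _))

∑-combine : ∀ m n (f : Fin (m * n) → ℕ) →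
            ∑[ i < m * n ] f i ≡ ∑[ u < m ] ∑[ v < n ] f (combine u v)
∑-combine zero    n f = refl
∑-combine (suc m) n f =
  trans (∑-↑ n (m * n) f)
        (cong (∑[ v < n ] f (v ↑ˡ m * n) +_) (∑-combine m n (λ i → f (n ↑ʳ i))))

∑-zero : ∀ {n} (f : Fin n → ℕ) → (∀ i → f i ≡ 0) → ∑[ i < n ] f i ≡ 0
∑-zero {n} f f≡0 = trans (sum-cong-≗ f≡0) (sum-replicate-zero n)

∑≡0⇒≡0 : ∀ {n} (f : Fin n → ℕ) → ∑[ i < n ] f i ≡ 0 → ∀ i → f i ≡ 0
∑≡0⇒≡0 f ∑≡0 zero    = m+n≡0⇒m≡0 (f zero) ∑≡0
∑≡0⇒≡0 f ∑≡0 (suc i) = ∑≡0⇒≡0 (λ j → f (suc j)) (m+n≡0⇒n≡0 (f zero) ∑≡0) i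

∑-mono-≤ : ∀ {n} {f g : Fin n → ℕ} → (∀ i → f i ≤ g i) → ∑[ i < n ] f i ≤ ∑[ i < n ] g i
∑-mono-≤ {zero}  f≤g = z≤n
∑-mono-≤ {suc n} f≤g = +-mono-≤ (f≤g zero) (∑-mono-≤ (λ i → f≤g (suc i)))

∑*∑ : ∀ {m n} (f : Fin m → ℕ) (g : Fin n → ℕ) →
      (∑[ i < m ] f i) * (∑[ j < n ] g j) ≡ ∑[ i < m ] ∑[ j < n ] (f i * g j)
∑*∑ {m} {n} f g =
  trans (*-distribʳ-sum (∑[ j < n ] g j) f) (sum-cong-≗ (λ i → *-distribˡ-sum (f i) g))

∑∑-mono-symmetric : ∀ {n} (f g : Fin n → Fin n → ℕ) →
                    (∀ i j → f i j + f j i ≤ g i j + g j i) →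
                    ∑[ i < n ] ∑[ j < n ] f i j ≤ ∑[ i < n ] ∑[ j < n ] g i j
∑∑-mono-symmetric {n} f g pairwise = +-cancel-double (begin
    ∑∑ f + ∑∑ f                              ≡⟨ cong (∑∑ f +_) (∑-comm f) ⟩
    ∑∑ f + ∑[ i < n ] ∑[ j < n ] f j i        ≡⟨ symmetrise f ⟩
    ∑[ i < n ] ∑[ j < n ] (f i j + f j i)     ≤⟨ ∑-mono-≤ (λ i → ∑-mono-≤ (pairwise i)) ⟩
    ∑[ i < n ] ∑[ j < n ] (g i j + g j i)     ≡⟨ symmetrise g ⟨
    ∑∑ g + ∑[ i < n ] ∑[ j < n ] g j i        ≡⟨ cong (∑∑ g +_) (∑-comm g) ⟨
    ∑∑ g + ∑∑ g                              ∎)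
  where
  open ≤-Reasoning
  ∑∑ : (Fin n → Fin n → ℕ) → ℕ
  ∑∑ h = ∑[ i < n ] ∑[ j < n ] h i j
  symmetrise : ∀ h → ∑∑ h + ∑[ i < n ] ∑[ j < n ] h j i ≡ ∑[ i < n ] ∑[ j < n ] (h i j + h j i)
  symmetrise h = trans (sym (∑-distrib-+ (λ i → ∑[ j < n ] h i j) _))
                       (sum-cong-≗ (λ i → sym (∑-distrib-+ (h i) (λ j → h j i))))
  +-cancel-double : ∀ {x y} → x + x ≤ y + y → x ≤ y
  +-cancel-double {x} {y} 2x≤2y with x ≤? y
  ... | yes x≤y = x≤y
  ... | no  x≰y = ⊥-elim (<⇒≱ (+-mono-< (≰⇒> x≰y) (≰⇒> x≰y)) 2x≤2y)

sum-map-allFin : ∀ n (f : Fin n → ℕ) → List.sum (map f (allFin n)) ≡ ∑[ i < n ] f i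
sum-map-allFin n f = trans (cong List.sum (map-tabulate (λ i → i) f)) (sum-tabulate n f)
  where
  sum-tabulate : ∀ n (f : Fin n → ℕ) → List.sum (tabulate f) ≡ ∑[ i < n ] f i
  sum-tabulate zero    f = refl
  sum-tabulate (suc n) f = cong (f zero +_) (sum-tabulate n (λ i → f (suc i)))

rearrangement : ∀ {a a′ b b′} → a′ ≤ a → b′ ≤ b → a * b′ + a′ * b ≤ a * b + a′ * b′
rearrangement {a′ = a′} {b′ = b′} a′≤a b′≤b
  with p , refl ← m≤n⇒∃[o]m+o≡n a′≤a | q , refl ← m≤n⇒∃[o]m+o≡n b′≤b =
  subst ((a′ + p) * b′ + a′ * (b′ + q) ≤_) (identity a′ p b′ q) (m≤m+n _ (p * q))
  where
  identity : ∀ a p b q → (a + p) * b + a * (b + q) + p * q ≡ (a + p) * (b + q) + a * b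
  identity = solve-∀

_≤lr_ : ∀ {n} → (Fin n → ℕ) → (Fin n → ℕ) → Set
x ≤lr x′ = ∀ {s s′} → toℕ s < toℕ s′ → x s′ * x′ s ≤ x s * x′ s′

-- The 2 × 2 Cauchy–Binet formula: after pairing the (s , t) and (t , s) terms of the two double
-- sums, each pair is an instance of the rearrangement inequality.
dot-exchange : ∀ {n} (x x′ y y′ : Fin n → ℕ) → x ≤lr x′ → y ≤lr y′ →
               (∑[ s < n ] (x s * y′ s)) * (∑[ s < n ] (x′ s * y s))
               ≤ (∑[ s < n ] (x s * y s)) * (∑[ s < n ] (x′ s * y′ s))
dot-exchange {n} x x′ y y′ x≤x′ y≤y′ = begin
  (∑[ s < n ] (x s * y′ s)) * (∑[ s < n ] (x′ s * y s))
    ≡⟨ ∑*∑ (λ s → x s * y′ s) (λ s → x′ s * y s) ⟩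
  ∑[ s < n ] ∑[ t < n ] f s t
    ≤⟨ ∑∑-mono-symmetric f g pairwise ⟩
  ∑[ s < n ] ∑[ t < n ] g s t
    ≡⟨ ∑*∑ (λ s → x s * y s) (λ s → x′ s * y′ s) ⟨
  (∑[ s < n ] (x s * y s)) * (∑[ s < n ] (x′ s * y′ s)) ∎
  where
  open ≤-Reasoning
  f g : Fin n → Fin n → ℕ
  f s t = x s * y′ s * (x′ t * y t)
  g s t = x s * y s * (x′ t * y′ t)
  pairwise< : ∀ {s t} → toℕ s < toℕ t → f s t + f t s ≤ g s t + g t s
  pairwise< {s} {t} s<t = begin
    f s t + f t s
      ≡⟨ regroupˡ (x s) (y′ s) (x′ t) (y t) (x t) (y′ t) (x′ s) (y s) ⟩
    (x s * x′ t) * (y t * y′ s) + (x t * x′ s) * (y s * y′ t)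
      ≤⟨ rearrangement (x≤x′ s<t) (y≤y′ s<t) ⟩
    (x s * x′ t) * (y s * y′ t) + (x t * x′ s) * (y t * y′ s)
      ≡⟨ regroupʳ (x s) (y s) (x′ t) (y′ t) (x t) (y t) (x′ s) (y′ s) ⟨
    g s t + g t s ∎
    where
    regroupˡ : ∀ a b c d e f g h → a * b * (c * d) + e * f * (g * h) ≡ (a * c) * (d * b) + (e * g) * (h * f)
    regroupˡ = solve-∀
    regroupʳ : ∀ a b c d e f g h → a * b * (c * d) + e * f * (g * h) ≡ (a * c) * (b * d) + (e * g) * (f * h)
    regroupʳ = solve-∀
  pairwise : ∀ s t → f s t + f t s ≤ g s t + g t s
  pairwise s t with Finₚ.<-cmp s t
  ... | tri< s<t _ _ = pairwise< s<t
  ... | tri≈ _ refl _ = ≤-reflexive (cong (λ z → z + z) (diagonal (x s) (x′ s) (y s) (y′ s)))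
    where
    diagonal : ∀ a a′ b b′ → a * b′ * (a′ * b) ≡ a * b * (a′ * b′)
    diagonal = solve-∀
  ... | tri> _ _ t<s = subst₂ _≤_ (+-comm (f t s) _) (+-comm (g t s) _) (pairwise< t<s)

LogConcaveSeq : (ℕ → ℕ) → Set
LogConcaveSeq a = ∀ i → a i * a (suc (suc i)) ≤ a (suc i) * a (suc i)

-- Unlike the usual notion this also excludes leading zeros; sphere sequences start with 1.
NoInternalZeros : (ℕ → ℕ) → Set
NoInternalZeros a = ∀ i → a i ≡ 0 → a (suc i) ≡ 0

logConcaveSeq-resp : ∀ {a b} → (∀ i → a i ≡ b i) → LogConcaveSeq a → LogConcaveSeq b
logConcaveSeq-resp a≗b lc i =
  subst₂ _≤_ (cong₂ _*_ (a≗b i) (a≗b (2 + i))) (cong₂ _*_ (a≗b (1 + i)) (a≗b (1 + i))) (lc i)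

logConcave-extend : ∀ {s d} → LogConcave s d → (∀ {i} → d < i → s i ≡ 0) → LogConcaveSeq s
logConcave-extend {s} {d} lc beyond i with 2 + i ≤? d
... | yes 2+i≤d = subst (λ j → s i * s j ≤ s (suc i) * s (suc i)) (+-comm (suc i) 1)
                    (lc (suc i) (s≤s z≤n) (subst (_≤ d) (+-comm 1 (suc i)) 2+i≤d))
... | no  2+i≰d rewrite beyond (≰⇒> 2+i≰d) | *-zeroʳ (s i) = z≤n

logConcave-restrict : ∀ {s} → LogConcaveSeq s → ∀ d → LogConcave s d
logConcave-restrict {s} lc d (suc i) _ _ =
  subst (λ j → s i * s j ≤ s (suc i) * s (suc i)) (+-comm 1 (suc i)) (lc i)

cross-≤-trans : ∀ p q r {s u v} .{{_ : NonZero s}} → p * s ≤ q * r → r * v ≤ s * u → p * v ≤ q * u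
cross-≤-trans p q r {s} {u} {v} ps≤qr rv≤su = *-cancelˡ-≤ s (begin
  s * (p * v)   ≡⟨ trans (sym (*-assoc s p v)) (cong (_* v) (*-comm s p)) ⟩
  p * s * v     ≤⟨ *-monoˡ-≤ v ps≤qr ⟩
  q * r * v     ≡⟨ *-assoc q r v ⟩
  q * (r * v)   ≤⟨ *-monoʳ-≤ q rv≤su ⟩
  q * (s * u)   ≡⟨ trans (sym (*-assoc q s u)) (trans (cong (_* u) (*-comm q s)) (*-assoc s q u)) ⟩
  s * (q * u)   ∎)
  where open ≤-Reasoning

lag : (ℕ → ℕ) → ℕ → ℕ → ℕ
lag a r       zero    = a r
lag a zero    (suc s) = 0
lag a (suc r) (suc s) = lag a r s

lag-≤ : ∀ (a : ℕ → ℕ) {r s} → s ≤ r → lag a r s ≡ a (r ∸ s)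
lag-≤ a {r}     {zero}  _         = refl
lag-≤ a {suc r} {suc s} (s≤s s≤r) = lag-≤ a s≤r

lag-> : ∀ (a : ℕ → ℕ) {r s} → r < s → lag a r s ≡ 0
lag-> a {zero}  {suc s} _         = refl
lag-> a {suc r} {suc s} (s≤s r<s) = lag-> a r<s

lag-suc : ∀ (a : ℕ → ℕ) {r s} → s ≤ r → lag a (suc r) s ≡ a (suc (r ∸ s))
lag-suc a {r}     {zero}  _         = refl
lag-suc a {suc r} {suc s} (s≤s s≤r) = lag-suc a s≤r

shift : (ℕ → ℕ) → ℕ → ℕ
shift b zero    = 0
shift b (suc s) = b s

module _ {a : ℕ → ℕ} (lc : LogConcaveSeq a) (niz : NoInternalZeros a) where

  logConcave-exchange : ∀ {x y} → x ≤ y → a x * a (suc y) ≤ a (suc x) * a y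
  logConcave-exchange {x} {zero}  z≤n = ≤-reflexive (*-comm (a 0) (a 1))
  logConcave-exchange {x} {suc y} x≤1+y with m≤n⇒m<n∨m≡n x≤1+y
  ... | inj₂ refl = ≤-reflexive (*-comm (a (suc y)) (a (suc (suc y))))
  ... | inj₁ (s≤s x≤y) with a (suc y) ≟ 0
  ...   | yes a[1+y]≡0 rewrite niz (suc y) a[1+y]≡0 | *-zeroʳ (a x) = z≤n
  ...   | no  a[1+y]≢0 =
    cross-≤-trans (a x) (a (suc x)) (a y) {{≢-nonZero a[1+y]≢0}} (logConcave-exchange x≤y) (lc y)

  lag-≤lr-lag-suc : ∀ r {N} → (λ (s : Fin N) → lag a r (toℕ s)) ≤lr (λ s → lag a (suc r) (toℕ s))
  lag-≤lr-lag-suc r {N} {s} {t} s<t with toℕ t ≤? r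
  ... | no  t≰r rewrite lag-> a (≰⇒> t≰r) = z≤n
  ... | yes t≤r with s≤r ← <⇒≤ (<-≤-trans s<t t≤r)
    rewrite lag-≤ a t≤r | lag-suc a s≤r | lag-≤ a s≤r | lag-suc a t≤r =
    ≤-trans (logConcave-exchange (∸-monoʳ-≤ r (<⇒≤ s<t)))
            (≤-reflexive (*-comm (a (suc (r ∸ toℕ t))) (a (r ∸ toℕ s))))

  ≤lr-shift : ∀ {N} → (λ (s : Fin N) → a (toℕ s)) ≤lr (λ s → shift a (toℕ s))
  ≤lr-shift {s = zero}  {t}     _         = ≤-trans (≤-reflexive (*-zeroʳ (a (toℕ t)))) z≤n
  ≤lr-shift {s = suc s} {suc t} (s≤s s<t) =
    ≤-trans (≤-reflexive (*-comm (a (suc (toℕ t))) (a (toℕ s)))) (logConcave-exchange (<⇒≤ s<t))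

conv : (ℕ → ℕ) → (ℕ → ℕ) → ℕ → ℕ
conv a b r = ∑[ s < suc r ] (a (r ∸ toℕ s) * b (toℕ s))

conv-cong : ∀ {a a′ b b′} → (∀ i → a i ≡ a′ i) → (∀ i → b i ≡ b′ i) →
            ∀ r → conv a b r ≡ conv a′ b′ r
conv-cong a≗a′ b≗b′ r = sum-cong-≗ {suc r} (λ s → cong₂ _*_ (a≗a′ (r ∸ toℕ s)) (b≗b′ (toℕ s)))

conv-lag : ∀ a b {r N} → r < N → conv a b r ≡ ∑[ s < N ] (lag a r (toℕ s) * b (toℕ s))
conv-lag a b {r} r<N with m≤n⇒∃[o]m+o≡n r<N
... | m , refl = sym (begin
  ∑[ s < suc r + m ] (lag a r (toℕ s) * b (toℕ s))
    ≡⟨ ∑-↑ (suc r) m (λ s → lag a r (toℕ s) * b (toℕ s)) ⟩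
  ∑[ s < suc r ] (lag a r (toℕ (s ↑ˡ m)) * b (toℕ (s ↑ˡ m)))
    + ∑[ j < m ] (lag a r (toℕ (suc r ↑ʳ j)) * b (toℕ (suc r ↑ʳ j)))
    ≡⟨ cong₂ _+_ (sum-cong-≗ inside) (∑-zero _ outside) ⟩
  conv a b r + 0
    ≡⟨ +-identityʳ _ ⟩
  conv a b r ∎)
  where
  open ≡-Reasoning
  inside : ∀ (s : Fin (suc r)) → lag a r (toℕ (s ↑ˡ m)) * b (toℕ (s ↑ˡ m)) ≡ a (r ∸ toℕ s) * b (toℕ s)
  inside s rewrite Finₚ.toℕ-↑ˡ s m = cong (_* b (toℕ s)) (lag-≤ a (Finₚ.toℕ≤pred[n] s))
  outside : ∀ (j : Fin m) → lag a r (toℕ (suc r ↑ʳ j)) * b (toℕ (suc r ↑ʳ j)) ≡ 0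
  outside j rewrite Finₚ.toℕ-↑ʳ (suc r) j | lag-> a (s≤s (m≤m+n r (toℕ j))) = refl

conv-shift : ∀ a b {r N} → r < N → conv a b r ≡ ∑[ s < suc N ] (lag a (suc r) (toℕ s) * shift b (toℕ s))
conv-shift a b {r} {N} r<N =
  trans (conv-lag a b r<N) (cong (_+ ∑[ s < N ] (lag a r (toℕ s) * b (toℕ s))) (sym (*-zeroʳ (a (suc r)))))

conv-logConcave : ∀ {a b} → LogConcaveSeq a → NoInternalZeros a → LogConcaveSeq b → NoInternalZeros b →
                  LogConcaveSeq (conv a b)
conv-logConcave {a} {b} lca niza lcb nizb k = begin
  conv a b k * conv a b (2 + k)
    ≡⟨ cong₂ _*_ (conv-shift a b (m≤n⇒m≤1+n (n<1+n k))) (conv-lag a b (n<1+n (2 + k))) ⟩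
  (∑[ s < 3 + k ] (x s * y′ s)) * (∑[ s < 3 + k ] (x′ s * y s))
    ≤⟨ dot-exchange x x′ y y′ (lag-≤lr-lag-suc lca niza (suc k)) (≤lr-shift lcb nizb) ⟩
  (∑[ s < 3 + k ] (x s * y s)) * (∑[ s < 3 + k ] (x′ s * y′ s))
    ≡⟨ cong₂ _*_ (conv-lag a b (n≤1+n (2 + k))) (conv-shift a b (n<1+n (suc k))) ⟨
  conv a b (1 + k) * conv a b (1 + k) ∎
  where
  open ≤-Reasoning
  x x′ y y′ : Fin (3 + k) → ℕ
  x  s = lag a (1 + k) (toℕ s)
  x′ s = lag a (2 + k) (toℕ s)
  y  s = b (toℕ s)
  y′ s = shift b (toℕ s)

δ : ℕ → ℕ → ℕ
δ m n = if m ≡ᵇ n then 1 else 0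

δ-≡ : ∀ {m n} → m ≡ n → δ m n ≡ 1
δ-≡ {zero}  refl = refl
δ-≡ {suc m} refl = δ-≡ {m} refl

δ-≢ : ∀ {m n} → m ≢ n → δ m n ≡ 0
δ-≢ {m} {n} m≢n with m ≡ᵇ n in eq
... | false = refl
... | true  = ⊥-elim (m≢n (≡ᵇ⇒≡ m n (subst T (sym eq) tt)))

∑-δ : ∀ {N} (f : ℕ → ℕ) β → β < N → ∑[ s < N ] (f (toℕ s) * δ β (toℕ s)) ≡ f β
∑-δ {suc N} f zero    _ =
  trans (cong (f 0 * 1 +_) (∑-zero {N} (λ s → f (suc (toℕ s)) * 0) (λ s → *-zeroʳ (f (suc (toℕ s))))))
        (trans (+-identityʳ _) (*-identityʳ (f 0)))
∑-δ {suc N} f (suc β) (s≤s β<N) = cong₂ _+_ (*-zeroʳ (f 0)) (∑-δ (λ s → f (suc s)) β β<N)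

δ-+ : ∀ α β i → δ (α + β) i ≡ conv (δ α) (δ β) i
δ-+ α β i with β ≤? i
... | yes β≤i = trans (shift-∸ α β≤i) (sym (∑-δ (λ s → δ α (i ∸ s)) β (s≤s β≤i)))
  where
  shift-∸ : ∀ α {β i} → β ≤ i → δ (α + β) i ≡ δ α (i ∸ β)
  shift-∸ α {zero}  z≤n rewrite +-identityʳ α = refl
  shift-∸ α {suc β} (s≤s β≤i) rewrite +-suc α β = shift-∸ α β≤i
... | no  β≰i = trans (δ-≢ (λ α+β≡i → β≰i (subst (β ≤_) α+β≡i (m≤n+m β α))))
                      (sym (∑-zero (λ s → δ α (i ∸ toℕ s) * δ β (toℕ s)) term≡0))
  where
  term≡0 : ∀ (s : Fin (suc i)) → δ α (i ∸ toℕ s) * δ β (toℕ s) ≡ 0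
  term≡0 s = trans (cong (δ α (i ∸ toℕ s) *_) (δ-≢ {β} {toℕ s} λ { refl → β≰i (Finₚ.toℕ≤pred[n] s) }))
                   (*-zeroʳ (δ α (i ∸ toℕ s)))

count : ∀ {n} → (Fin n → ℕ) → ℕ → ℕ
count {n} α j = ∑[ u < n ] δ (α u) j

count-+ : ∀ {m n} (α : Fin m → ℕ) (β : Fin n → ℕ) i →
          ∑[ u < m ] ∑[ v < n ] δ (α u + β v) i ≡ conv (count α) (count β) i
count-+ {m} {n} α β i = begin
  ∑[ u < m ] ∑[ v < n ] δ (α u + β v) i
    ≡⟨ sum-cong-≗ (λ u → sum-cong-≗ (λ v → δ-+ (α u) (β v) i)) ⟩
  ∑[ u < m ] ∑[ v < n ] ∑[ s < suc i ] term u v s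
    ≡⟨ sum-cong-≗ (λ u → ∑-comm (term u)) ⟩
  ∑[ u < m ] ∑[ s < suc i ] ∑[ v < n ] term u v s
    ≡⟨ ∑-comm (λ u s → ∑[ v < n ] term u v s) ⟩
  ∑[ s < suc i ] ∑[ u < m ] ∑[ v < n ] term u v s
    ≡⟨ sum-cong-≗ {suc i} (λ s → ∑*∑ (λ u → δ (α u) (i ∸ toℕ s)) (λ v → δ (β v) (toℕ s))) ⟨
  conv (count α) (count β) i ∎
  where
  open ≡-Reasoning
  term : Fin m → Fin n → Fin (suc i) → ℕ
  term u v s = δ (α u) (i ∸ toℕ s) * δ (β v) (toℕ s)

count-beyond : ∀ {n} {α : Fin n → ℕ} {d i} → (∀ u → α u ≤ d) → d < i → count α i ≡ 0
count-beyond {α = α} {i = i} α≤d d<i = ∑-zero (λ u → δ (α u) i) (λ u → δ-≢ {α u} {i} λ { refl → <⇒≱ d<i (α≤d u) })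

T-injective : ∀ {b c} → T b ⇔ T c → b ≡ c
T-injective {false} {false} _   = refl
T-injective {false} {true}  b⇔c = contradiction (Equivalence.from b⇔c tt) λ ()
T-injective {true}  {false} b⇔c = contradiction (Equivalence.to b⇔c tt) λ ()
T-injective {true}  {true}  _   = refl

T-not⁺ : ∀ {b} → ¬ T b → T (not b)
T-not⁺ {false} _  = tt
T-not⁺ {true}  ¬b = ¬b tt

T-not⁻ : ∀ {b} → T (not b) → ¬ T b
T-not⁻ {false} _ ()

any-upTo⁺ : ∀ (P : ℕ → Bool) {i j} → j < i → T (P j) → T (any P (upTo i))
any-upTo⁺ P j<i Pj = any⁺ P (lose (∈-upTo⁺ j<i) Pj)

any-upTo⁻ : ∀ (P : ℕ → Bool) {i} → T (any P (upTo i)) → ∃[ j ] (j < i × T (P j))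
any-upTo⁻ P {i} h with j , j∈ , Pj ← find (any⁻ P (upTo i) h) = j , ∈-upTo⁻ j∈ , Pj

IsLeast : (ℕ → Bool) → ℕ → Set
IsLeast P D = T (P D) × (∀ {k} → T (P k) → D ≤ k)

least : ∀ (P : ℕ → Bool) k → T (P k) → ∃ (IsLeast P)
least P zero    P0 = 0 , P0 , λ _ → z≤n
least P (suc k) Pk with T? (P 0)
... | yes P0 = 0 , P0 , λ _ → z≤n
... | no ¬P0 with D , PD , minimal ← least (P ∘ suc) k Pk = suc D , PD , above
  where
  above : ∀ {j} → T (P j) → suc D ≤ j
  above {zero}  P0 = contradiction P0 ¬P0
  above {suc j} Pj = s≤s (minimal Pj)

least-≡ᵇ : ∀ {P D} → IsLeast P D → ∀ i → (P i ∧ not (any P (upTo i))) ≡ (D ≡ᵇ i)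
least-≡ᵇ {P} {D} (PD , minimal) i = T-injective (mk⇔ first⇒D≡i D≡i⇒first)
  where
  first⇒D≡i : T (P i ∧ not (any P (upTo i))) → T (D ≡ᵇ i)
  first⇒D≡i h with Pi , ¬earlier ← Equivalence.to T-∧ h =
    ≡⇒≡ᵇ D i (≤-antisym (minimal Pi) (≮⇒≥ (λ D<i → T-not⁻ ¬earlier (any-upTo⁺ P D<i PD))))
  D≡i⇒first : T (D ≡ᵇ i) → T (P i ∧ not (any P (upTo i)))
  D≡i⇒first h with refl ← ≡ᵇ⇒≡ D i h = Equivalence.from T-∧ (PD , T-not⁺ noEarlier)
    where
    noEarlier : ¬ T (any P (upTo D))
    noEarlier earlier with j , j<D , Pj ← any-upTo⁻ P earlier = <⇒≱ j<D (minimal Pj)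

module _ (G : Graph) where

  private
    V = Fin (n G)

  infixr 5 _∷_
  data Walk : ℕ → V → V → Set where
    []  : ∀ {x} → Walk 0 x x
    _∷_ : ∀ {k x z y} → T (adj G x z) → Walk k z y → Walk (suc k) x y

  fromWalk : ∀ {k x y} → Walk k x y → T (walk G k x y)
  fromWalk {x = x} []                   = fromWitness {a? = x Finₚ.≟ x} refl
  fromWalk {suc k} {x} {y} (_∷_ {z = z} xz zy) =
    any⁺ (λ w → adj G x w ∧ walk G k w y) (lose (∈-allFin z) (Equivalence.from T-∧ (xz , fromWalk zy)))

  toWalk : ∀ k {x y} → T (walk G k x y) → Walk k x y
  toWalk zero    {x} {y} h with refl ← toWitness {a? = x Finₚ.≟ y} h = []
  toWalk (suc k) {x} {y} h
    with z , xzy ← satisfied (any⁻ (λ w → adj G x w ∧ walk G k w y) (allFin (n G)) h)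
    with xz , zy ← Equivalence.to T-∧ xzy = xz ∷ toWalk k zy

  _++_ : ∀ {a b x z y} → Walk a x z → Walk b z y → Walk (a + b) x y
  []        ++ zy = zy
  (xw ∷ wz) ++ zy = xw ∷ (wz ++ zy)

  splitWalk : ∀ a {b x y} → Walk (a + b) x y → ∃[ z ] (Walk a x z × Walk b z y)
  splitWalk zero    {x = x} xy = x , [] , xy
  splitWalk (suc a) (xw ∷ wy) with z , wz , zy ← splitWalk a wy = z , xw ∷ wz , zy

  IsDistance : (V → V → ℕ) → Set
  IsDistance D = ∀ x y → Walk (D x y) x y × (∀ {k} → Walk k x y → D x y ≤ k)

  private
    leastWalk : Connected G → ∀ x y → ∃ (IsLeast (λ k → walk G k x y))
    leastWalk conn x y =
      least (λ k → walk G k x y) (proj₁ (conn x y)) (Equivalence.from T-≡ (proj₂ (conn x y)))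

  dist : Connected G → V → V → ℕ
  dist conn x y = proj₁ (leastWalk conn x y)

  dist-isDistance : (conn : Connected G) → IsDistance (dist conn)
  dist-isDistance conn x y with D , walk-D , minimal ← leastWalk conn x y =
    toWalk D walk-D , λ w → minimal (fromWalk w)

  module _ {D : V → V → ℕ} (isDist : IsDistance D) where

    distIs≡ᵇ : ∀ i x y → distIs G i x y ≡ (D x y ≡ᵇ i)
    distIs≡ᵇ i x y =
      least-≡ᵇ (fromWalk (proj₁ (isDist x y)) , λ {k} h → proj₂ (isDist x y) (toWalk k h)) i

    distIs⇔ : ∀ i x y → distIs G i x y ≡ true ⇔ D x y ≡ i
    distIs⇔ i x y = mk⇔
      (λ h → ≡ᵇ⇒≡ (D x y) i (Equivalence.from T-≡ (trans (sym (distIs≡ᵇ i x y)) h)))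
      (λ h → trans (distIs≡ᵇ i x y) (Equivalence.to T-≡ (≡⇒≡ᵇ (D x y) i h)))

    sphere≡count : ∀ x i → sphere G x i ≡ count (D x) i
    sphere≡count x i =
      trans (sum-map-allFin (n G) _) (sum-cong-≗ (λ y → cong (if_then 1 else 0) (distIs≡ᵇ i x y)))

    distance-pred : ∀ {x y j} → D x y ≡ suc j → ∃[ z ] D x z ≡ j
    distance-pred {x} {y} {j} Dxy≡1+j
      with z , xz , zy ← splitWalk j (subst (λ k → Walk k x y) (trans Dxy≡1+j (+-comm 1 j)) (proj₁ (isDist x y)))
      =
      z , ≤-antisym (proj₂ (isDist x z) xz) (≤-pred (begin
        suc j           ≡⟨ Dxy≡1+j ⟨
        D x y           ≤⟨ proj₂ (isDist x y) (proj₁ (isDist x z) ++ zy) ⟩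
        D x z + 1       ≡⟨ +-comm (D x z) 1 ⟩
        suc (D x z)     ∎))
      where open ≤-Reasoning

    count-noInternalZeros : ∀ x → NoInternalZeros (count (D x))
    count-noInternalZeros x j none = ∑-zero _ (λ y → δ-≢ (nobody-further y))
      where
      nobody-further : ∀ y → D x y ≢ suc j
      nobody-further y Dxy≡1+j with z , Dxz≡j ← distance-pred Dxy≡1+j =
        1+n≢0 (trans (sym (δ-≡ Dxz≡j)) (∑≡0⇒≡0 _ none z))

    distance-≤-diameter : ∀ d → IsDiameter G d → ∀ x y → D x y ≤ d
    distance-≤-diameter d (within , _) x y
      with j , j≤d , walk-j ← any-upTo⁻ (λ k → walk G k x y) (Equivalence.from T-≡ (within x y)) =
      ≤-trans (proj₂ (isDist x y) (toWalk j walk-j)) (≤-pred j≤d)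

module _ {G : Graph} (conn : Connected G) where

  sphere-beyond : ∀ d → IsDiameter G d → ∀ x {i} → d < i → sphere G x i ≡ 0
  sphere-beyond d diam x {i} d<i =
    trans (sphere≡count G isDist x i) (count-beyond (distance-≤-diameter G isDist d diam x) d<i)
    where isDist = dist-isDistance G conn

  sphere-noInternalZeros : ∀ x → NoInternalZeros (sphere G x)
  sphere-noInternalZeros x j none = trans (sphere≡count G isDist x (suc j))
    (count-noInternalZeros G isDist x j (trans (sym (sphere≡count G isDist x j)) none))
    where isDist = dist-isDistance G conn

  sphere-logConcave : ∀ d → IsDiameter G d → ∀ x →
                      LogConcave (sphere G x) d → LogConcaveSeq (sphere G x)
  sphere-logConcave d diam x lc = logConcave-extend {d = d} lc (sphere-beyond d diam x)

  sphere-uniform : DDR G → ∀ d → IsDiameter G d → ∀ j x y → sphere G x j ≡ sphere G y j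
  sphere-uniform ddr d diam j x y with j ≤? d
  ... | yes j≤d = ddr d diam j j≤d x y
  ... | no  j≰d = trans (sphere-beyond d diam x (≰⇒> j≰d)) (sym (sphere-beyond d diam y (≰⇒> j≰d)))

module _ (A B : Graph) where

  private
    fst = fstV A B
    snd = sndV A B

  fst-combine : ∀ u v → fstV A B (combine u v) ≡ u
  fst-combine u v = cong proj₁ (Finₚ.remQuot-combine {n A} {n B} u v)

  snd-combine : ∀ u v → sndV A B (combine u v) ≡ v
  snd-combine u v = cong proj₂ (Finₚ.remQuot-combine {n A} {n B} u v)

  combine-fst-snd : ∀ p → combine (fstV A B p) (sndV A B p) ≡ p
  combine-fst-snd = Finₚ.combine-remQuot {n A} (n B)

  CartesianAdj : Fin (n A * n B) → Fin (n A * n B) → Set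
  CartesianAdj p q = (fst p ≡ fst q × T (adj B (snd p) (snd q)))
                   ⊎ (snd p ≡ snd q × T (adj A (fst p) (fst q)))

  adj-□⇔ : ∀ {p q} → T (adj (A □ B) p q) ⇔ CartesianAdj p q
  adj-□⇔ {p} {q} = mk⇔ to from
    where
    to : T (adj (A □ B) p q) → CartesianAdj p q
    to pq with Equivalence.to T-∨ pq
    ... | inj₁ h with same , adjB ← Equivalence.to T-∧ h =
      inj₁ (toWitness {a? = fst p Finₚ.≟ fst q} same , adjB)
    ... | inj₂ h with same , adjA ← Equivalence.to T-∧ h =
      inj₂ (toWitness {a? = snd p Finₚ.≟ snd q} same , adjA)
    from : CartesianAdj p q → T (adj (A □ B) p q)
    from (inj₁ (same , adjB)) =
      Equivalence.from T-∨ (inj₁ (Equivalence.from T-∧ (fromWitness {a? = fst p Finₚ.≟ fst q} same , adjB)))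
    from (inj₂ (same , adjA)) =
      Equivalence.from T-∨ (inj₂ (Equivalence.from T-∧ (fromWitness {a? = snd p Finₚ.≟ snd q} same , adjA)))

  adj-□ᴬ : ∀ {u u′ v} → T (adj A u u′) → T (adj (A □ B) (combine u v) (combine u′ v))
  adj-□ᴬ {u} {u′} {v} uu′ = Equivalence.from adj-□⇔ (inj₂
    ( trans (snd-combine u v) (sym (snd-combine u′ v))
    , subst₂ (λ x y → T (adj A x y)) (sym (fst-combine u v)) (sym (fst-combine u′ v)) uu′))

  adj-□ᴮ : ∀ {u v v′} → T (adj B v v′) → T (adj (A □ B) (combine u v) (combine u v′))
  adj-□ᴮ {u} {v} {v′} vv′ = Equivalence.from adj-□⇔ (inj₁
    ( trans (fst-combine u v) (sym (fst-combine u v′))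
    , subst₂ (λ x y → T (adj B x y)) (sym (snd-combine u v)) (sym (snd-combine u v′)) vv′))

  walk-□⁺ : ∀ {a b u u′ v v′} → Walk A a u u′ → Walk B b v v′ →
            Walk (A □ B) (a + b) (combine u v) (combine u′ v′)
  walk-□⁺ (uw ∷ wu′) vv′        = adj-□ᴬ uw ∷ walk-□⁺ wu′ vv′
  walk-□⁺ []         (vw ∷ wv′) = adj-□ᴮ vw ∷ walk-□⁺ [] wv′
  walk-□⁺ []         []         = []

  walk-□⁻ : ∀ {k p q} → Walk (A □ B) k p q →
            ∃[ a ] ∃[ b ] (a + b ≡ k × Walk A a (fst p) (fst q) × Walk B b (snd p) (snd q))
  walk-□⁻ [] = 0 , 0 , refl , [] , []
  walk-□⁻ {q = q} (pz ∷ zq) with a , b , refl , wA , wB ← walk-□⁻ zq | Equivalence.to adj-□⇔ pz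
  ... | inj₁ (same , adjB) = a , suc b , +-suc a b , subst (λ u → Walk A a u (fst q)) (sym same) wA , adjB ∷ wB
  ... | inj₂ (same , adjA) = suc a , b , refl , adjA ∷ wA , subst (λ v → Walk B b v (snd q)) (sym same) wB

  isDistance-□ : ∀ {D E} → IsDistance A D → IsDistance B E →
                 IsDistance (A □ B) (λ p q → D (fst p) (fst q) + E (snd p) (snd q))
  isDistance-□ {D} {E} isD isE p q = shortest , minimal
    where
    shortest : Walk (A □ B) (D (fst p) (fst q) + E (snd p) (snd q)) p q
    shortest = subst₂ (Walk (A □ B) _) (combine-fst-snd p) (combine-fst-snd q)
                      (walk-□⁺ (proj₁ (isD (fst p) (fst q))) (proj₁ (isE (snd p) (snd q))))
    minimal : ∀ {k} → Walk (A □ B) k p q → D (fst p) (fst q) + E (snd p) (snd q) ≤ k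
    minimal w with a , b , refl , wA , wB ← walk-□⁻ w =
      +-mono-≤ (proj₂ (isD _ _) wA) (proj₂ (isE _ _) wB)

  module _ (connA : Connected A) (connB : Connected B) where

    private
      distA = dist A connA
      distB = dist B connB
      isDistA = dist-isDistance A connA
      isDistB = dist-isDistance B connB
      isDist□ = isDistance-□ isDistA isDistB

    sphere-□ : ∀ p i → sphere (A □ B) p i ≡ conv (sphere A (fst p)) (sphere B (snd p)) i
    sphere-□ p i = begin
      sphere (A □ B) p i
        ≡⟨ sphere≡count (A □ B) isDist□ p i ⟩
      ∑[ q < n A * n B ] δ (distA (fst p) (fst q) + distB (snd p) (snd q)) i
        ≡⟨ ∑-combine (n A) (n B) _ ⟩
      ∑[ u < n A ] ∑[ v < n B ] δ (distA (fst p) (fst (combine u v)) + distB (snd p) (snd (combine u v))) i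
        ≡⟨ sum-cong-≗ (λ u → sum-cong-≗ (λ v →
             cong₂ (λ u′ v′ → δ (distA (fst p) u′ + distB (snd p) v′) i) (fst-combine u v) (snd-combine u v))) ⟩
      ∑[ u < n A ] ∑[ v < n B ] δ (distA (fst p) u + distB (snd p) v) i
        ≡⟨ count-+ (distA (fst p)) (distB (snd p)) i ⟩
      conv (count (distA (fst p))) (count (distB (snd p))) i
        ≡⟨ conv-cong (sphere≡count A isDistA (fst p)) (sphere≡count B isDistB (snd p)) i ⟨
      conv (sphere A (fst p)) (sphere B (snd p)) i ∎
      where open ≡-Reasoning

    diameter-□ : ∀ dA dB → IsDiameter A dA → IsDiameter B dB → IsDiameter (A □ B) (dA + dB)
    diameter-□ dA dB diamA@(_ , a₁ , a₂ , a₁a₂) diamB@(_ , b₁ , b₂ , b₁b₂) =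
      within , combine a₁ b₁ , combine a₂ b₂ ,
      Equivalence.from (distIs⇔ (A □ B) isDist□ (dA + dB) (combine a₁ b₁) (combine a₂ b₂)) far
      where
      within : ∀ p q → walkBelow (A □ B) (suc (dA + dB)) p q ≡ true
      within p q = Equivalence.to T-≡ (any-upTo⁺ (λ k → walk (A □ B) k p q)
        (s≤s (+-mono-≤ (distance-≤-diameter A isDistA dA diamA (fst p) (fst q))
                       (distance-≤-diameter B isDistB dB diamB (snd p) (snd q))))
        (fromWalk (A □ B) (proj₁ (isDist□ p q))))
      far : distA (fst (combine a₁ b₁)) (fst (combine a₂ b₂)) + distB (snd (combine a₁ b₁)) (snd (combine a₂ b₂))
            ≡ dA + dB
      far = cong₂ _+_
        (trans (cong₂ distA (fst-combine a₁ b₁) (fst-combine a₂ b₂)) (Equivalence.to (distIs⇔ A isDistA dA a₁ a₂) a₁a₂))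
        (trans (cong₂ distB (snd-combine a₁ b₁) (snd-combine a₂ b₂)) (Equivalence.to (distIs⇔ B isDistB dB b₁ b₂) b₁b₂))

    sphere-□-combine : ∀ u v i → sphere (A □ B) (combine u v) i ≡ conv (sphere A u) (sphere B v) i
    sphere-□-combine u v i = trans (sphere-□ (combine u v) i)
      (cong₂ (λ u′ v′ → conv (sphere A u′) (sphere B v′) i) (fst-combine u v) (snd-combine u v))

corollary1 : (A B : Graph) → Connected A → Connected B → DDR A → LC A → DDR B → LC B → DDR (A □ B) × LC (A □ B)
corollary1 A B connA connB ddrA (dA , diamA , xA , lcA) ddrB (dB , diamB , xB , lcB) = ddr□ , lc□
  where
  ddr□ : DDR (A □ B)
  ddr□ _ _ i _ p q = begin
    sphere (A □ B) p i
      ≡⟨ sphere-□ A B connA connB p i ⟩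
    conv (sphere A (fstV A B p)) (sphere B (sndV A B p)) i
      ≡⟨ conv-cong (λ j → sphere-uniform connA ddrA dA diamA j (fstV A B p) (fstV A B q))
                   (λ j → sphere-uniform connB ddrB dB diamB j (sndV A B p) (sndV A B q)) i ⟩
    conv (sphere A (fstV A B q)) (sphere B (sndV A B q)) i
      ≡⟨ sphere-□ A B connA connB q i ⟨
    sphere (A □ B) q i ∎
    where open ≡-Reasoning

  logConcave□ : LogConcaveSeq (sphere (A □ B) (combine xA xB))
  logConcave□ = logConcaveSeq-resp (λ i → sym (sphere-□-combine A B connA connB xA xB i))
    (conv-logConcave (sphere-logConcave connA dA diamA xA lcA) (sphere-noInternalZeros connA xA)
                     (sphere-logConcave connB dB diamB xB lcB) (sphere-noInternalZeros connB xB))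

  lc□ : LC (A □ B)
  lc□ = dA + dB , diameter-□ A B connA connB dA dB diamA diamB , combine xA xB ,
        logConcave-restrict {sphere (A □ B) (combine xA xB)} logConcave□ (dA + dB)
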